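{- As an identity of formal power series in $q$ with coefficients polynomial in $t$, \[ \sum_{n\geq0}\frac{q^{n(n+1)}\,(-t q;q^2)_n}{(q^2;q^2)_{n}\,(t q;q^2)_{n+1}}\;=\;\frac{(-q^2;q^2)_\infty}{(t q;q^2)_\infty}. \]
   Context: For a monomial $a$ (possibly involving $t$) and $k\ge 1$, $(a;q)_k=(1-a)(1-aq)\cdots(1-aq^{k-1})$, $(a;q)_0=1$, and $(a;q)_\infty=\prod_{j\ge 0}(1-aq^j)$; the same notation is used with $q$ replaced by $q^2$. -}

module Defs where

open import Data.Nat as ℕ using (ℕ; zero; suc; _∸_; _≟_)
open import Data.Integer using (ℤ; 0ℤ; 1ℤ; _+_; _*_; -_)
open import Data.Fin using (Fin; toℕ)
open import Data.Vec using (Vec; []; _∷_; lookup; head)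
open import Relation.Nullary using (yes; no)

Σ< : ℕ → (ℕ → ℤ) → ℤ
Σ< zero    h = 0ℤ
Σ< (suc n) h = Σ< n h + h n

Σ≤ : ℕ → (ℕ → ℤ) → ℤ
Σ≤ k h = Σ< (suc k) h

-- Coefficient ring: power series in t (elements of ℤ[[t]]; the
-- coefficients occurring here are in fact polynomials in t).
-- f k = coefficient of t^k.

T : Set
T = ℕ → ℤ

0T : T
0T _ = 0ℤ

1T : T
1T zero    = 1ℤ
1T (suc _) = 0ℤ

_+T_ : T → T → T
(f +T g) k = f k + g k

-T_ : T → T
(-T f) k = - f k

_*T_ : T → T → T
(f *T g) k = Σ≤ k (λ j → f j * g (k ∸ j))

ΣFinT : (n : ℕ) → (Fin n → T) → T
ΣFinT zero    h = 0T
ΣFinT (suc n) h = h Data.Fin.zero +T ΣFinT n (λ i → h (Data.Fin.suc i))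

-- Formal power series in q with coefficients in T:
-- f m k = coefficient of q^m t^k.

S : Set
S = ℕ → T

0S : S
0S _ = 0T

1S : S
1S zero    = 1T
1S (suc _) = 0T

_+S_ : S → S → S
(f +S g) m = f m +T g m

_*S_ : S → S → S
(f *S g) m k = Σ≤ m (λ i → Σ≤ k (λ j → f i j * g (m ∸ i) (k ∸ j)))

mono : ℤ → ℕ → ℕ → S
mono c a b m k with m ≟ a | k ≟ b
... | yes _ | yes _ = c
... | _     | _     = 0ℤ

oneMinus : ℤ → ℕ → ℕ → S
oneMinus c a b m k = 1S m k + (- mono c a b m k)

-- Multiplicative inverse of a series f whose q^0 coefficient is 1
-- (i.e. f 0 = 1T).  Coefficients g_0 = 1, and for m ≥ 0
--   g_{m+1} = - Σ_{i=0}^{m} f_{i+1} g_{m-i},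
-- which is the unique solution of f * g = 1 in that case.
-- invVec f m = [g_m , g_{m-1} , ... , g_0].
invVec : S → (m : ℕ) → Vec T (suc m)
invVec f zero    = 1T ∷ []
invVec f (suc m) = gnext ∷ prev
  where
    prev : Vec T (suc m)
    prev = invVec f m
    gnext : T
    gnext = -T ΣFinT (suc m) (λ i → f (suc (toℕ i)) *T lookup prev i)

inv : S → S
inv f m = head (invVec f m)

-- q-Pochhammer symbols for a monomial a = c q^d t^e with base q^s:
--   (a;q^s)_n = ∏_{j<n} (1 - c q^(d + s j) t^e)

poch : ℤ → ℕ → ℕ → ℕ → ℕ → S
poch c d e s zero    = 1S
poch c d e s (suc n) = poch c d e s n *S oneMinus c (d ℕ.+ s ℕ.* n) e

-- (a;q^s)_∞ , defined q-adically (coefficientwise limit):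
-- when s ≥ 1 every factor with index j ≥ m+1 is ≡ 1 mod q^(m+1), so
-- the coefficient of q^m of the infinite product is that of the
-- product of the first m+1 factors.
pochInf : ℤ → ℕ → ℕ → ℕ → S
pochInf c d e s m = poch c d e s (suc m) m

-1ℤ : ℤ
-1ℤ = - 1ℤ

summand : ℕ → S
summand n =
  ((mono 1ℤ (n ℕ.* suc n) 0 *S poch -1ℤ 1 1 2 n)
     *S inv (poch 1ℤ 2 0 2 n))
     *S inv (poch 1ℤ 1 1 2 (suc n))

partialSum : ℕ → S
partialSum zero    = 0S
partialSum (suc N) = partialSum N +S summand N

rhs : S
rhs = pochInf -1ℤ 2 0 2 *S inv (pochInf 1ℤ 1 1 2)

-- Write x = q² and a = tq.  By induction on N, using the q-Pascal rule and replacing a by a x in one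
-- half of the sum,
--   Σ_{n≤N} x^{n(n+1)/2} [N n]_x (-a;x)_n (a x^{n+1};x)_{N-n} = (-x;x)_N .
-- Dividing by (a;x)_{N+1} turns the n-th term into x^{n(n+1)/2} [N n]_x (-a;x)_n / (a;x)_{n+1}.
-- Since [N n]_x ≡ 1/(x;x)_n mod x^{N-n+1} and x^{n(n+1)/2} is divisible by x^n, the partial sum of the
-- theorem up to N agrees with (-x;x)_N / (a;x)_{N+1} modulo q^{2N+2}; so does the right-hand side, and
-- all later summands are divisible by q^{2N+2}.

module Submission where

open import Defs
open import Algebra using (CommutativeRing; RawRing)
open import Level using (Level)
open import Data.Nat as ℕ using (ℕ; zero; suc; _∸_; _<_; _≤_; z≤n; s≤s)
import Data.Nat.Properties as ℕ
open import Data.Integer as ℤ using (ℤ; +_; -[1+_]; 1ℤ)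
import Data.Integer.Properties as ℤ
open import Data.Fin as Fin using (Fin; toℕ)
open import Data.Vec using (lookup)
open import Data.Maybe using (Maybe; just; nothing)
open import Data.Product using (∃; _,_)
open import Data.Sum using (inj₁; inj₂)
open import Data.Empty using (⊥-elim)
open import Relation.Nullary using (yes; no; ¬_)
open import Relation.Binary.PropositionalEquality as ≡ using (_≡_)
open import Data.Nat.Tactic.RingSolver using (solve-∀)

module IntegerCoefficientSolver {c ℓ : Level} (R : CommutativeRing c ℓ) where
  open CommutativeRing R hiding (zero)
  open import Relation.Binary.Reasoning.Setoid setoid
  open import Algebra.Properties.Semiring.Mult.TCOptimised semiring using (_×_; ×-homo-+; ×1-homo-*)
  open import Algebra.Properties.Ring ring
    using (-‿involutive; -0#≈0#; -‿+-comm; -‿distribʳ-*; -‿distribˡ-*)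
  open import Algebra.Properties.CommutativeSemigroup +-commutativeSemigroup using (interchange)
  import Algebra.Solver.Ring.AlmostCommutativeRing as ACR

  fromℤ : ℤ → Carrier
  fromℤ (+ n)      = n × 1#
  fromℤ (-[1+ n ]) = - (suc n × 1#)

  fromℤ-cong : ∀ {i j} → i ≡ j → fromℤ i ≈ fromℤ j
  fromℤ-cong i≡j = reflexive (≡.cong fromℤ i≡j)

  fromℤ-homo-neg : ∀ i → fromℤ (ℤ.- i) ≈ - fromℤ i
  fromℤ-homo-neg (+ zero)  = sym -0#≈0#
  fromℤ-homo-neg (+ suc n) = refl
  fromℤ-homo-neg -[1+ n ]  = sym (-‿involutive _)

  ×1-suc : ∀ n → suc n × 1# ≈ 1# + n × 1#
  ×1-suc n = ×-homo-+ 1# 1 n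

  fromℤ-homo-⊖ : ∀ m n → fromℤ (m ℤ.⊖ n) ≈ m × 1# + - (n × 1#)
  fromℤ-homo-⊖ m zero = begin
    fromℤ (m ℤ.⊖ zero)  ≈⟨ fromℤ-cong (ℤ.⊖-≥ {m} ℕ.z≤n) ⟩
    m × 1#              ≈⟨ sym (+-identityʳ _) ⟩
    m × 1# + 0#         ≈⟨ +-congˡ (sym -0#≈0#) ⟩
    m × 1# + - 0#       ∎
  fromℤ-homo-⊖ zero (suc n) = sym (+-identityˡ _)
  fromℤ-homo-⊖ (suc m) (suc n) = begin
    fromℤ (suc m ℤ.⊖ suc n)              ≈⟨ fromℤ-cong (ℤ.[1+m]⊖[1+n]≡m⊖n m n) ⟩
    fromℤ (m ℤ.⊖ n)                      ≈⟨ fromℤ-homo-⊖ m n ⟩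
    m × 1# + - (n × 1#)                  ≈⟨ sym (+-identityˡ _) ⟩
    0# + (m × 1# + - (n × 1#))           ≈⟨ +-congʳ (sym (-‿inverseʳ 1#)) ⟩
    (1# + - 1#) + (m × 1# + - (n × 1#))  ≈⟨ interchange 1# (- 1#) (m × 1#) (- (n × 1#)) ⟩
    (1# + m × 1#) + (- 1# + - (n × 1#))  ≈⟨ +-cong (sym (×1-suc m)) (trans (-‿+-comm _ _) (-‿cong (sym (×1-suc n)))) ⟩
    suc m × 1# + - (suc n × 1#)          ∎

  fromℤ-homo-+ : ∀ i j → fromℤ (i ℤ.+ j) ≈ fromℤ i + fromℤ j
  fromℤ-homo-+ -[1+ m ] -[1+ n ] = begin
    - (suc (suc (m ℕ.+ n)) × 1#)      ≈⟨ -‿cong (reflexive (≡.cong (_× 1#) (≡.cong suc (≡.sym (ℕ.+-suc m n))))) ⟩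
    - ((suc m ℕ.+ suc n) × 1#)        ≈⟨ -‿cong (×-homo-+ 1# (suc m) (suc n)) ⟩
    - (suc m × 1# + suc n × 1#)       ≈⟨ sym (-‿+-comm _ _) ⟩
    - (suc m × 1#) + - (suc n × 1#)   ∎
  fromℤ-homo-+ -[1+ m ] (+ n)    = trans (fromℤ-homo-⊖ n (suc m)) (+-comm _ _)
  fromℤ-homo-+ (+ m)    -[1+ n ] = fromℤ-homo-⊖ m (suc n)
  fromℤ-homo-+ (+ m)    (+ n)    = ×-homo-+ 1# m n

  fromℤ-homo-*-+ : ∀ m j → fromℤ (+ m ℤ.* j) ≈ m × 1# * fromℤ j
  fromℤ-homo-*-+ m (+ n) = trans (fromℤ-cong (≡.sym (ℤ.pos-* m n))) (×1-homo-* m n)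
  fromℤ-homo-*-+ m -[1+ n ] = begin
    fromℤ (+ m ℤ.* -[1+ n ])        ≈⟨ fromℤ-cong (≡.sym (ℤ.neg-distribʳ-* (+ m) (+ suc n))) ⟩
    fromℤ (ℤ.- (+ m ℤ.* + suc n))   ≈⟨ fromℤ-homo-neg (+ m ℤ.* + suc n) ⟩
    - fromℤ (+ m ℤ.* + suc n)       ≈⟨ -‿cong (fromℤ-homo-*-+ m (+ suc n)) ⟩
    - (m × 1# * suc n × 1#)         ≈⟨ -‿distribʳ-* _ _ ⟩
    m × 1# * - (suc n × 1#)         ∎

  fromℤ-homo-* : ∀ i j → fromℤ (i ℤ.* j) ≈ fromℤ i * fromℤ j
  fromℤ-homo-* (+ m)    j = fromℤ-homo-*-+ m j
  fromℤ-homo-* -[1+ m ] j = begin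
    fromℤ (-[1+ m ] ℤ.* j)          ≈⟨ fromℤ-cong (≡.sym (ℤ.neg-distribˡ-* (+ suc m) j)) ⟩
    fromℤ (ℤ.- (+ suc m ℤ.* j))     ≈⟨ fromℤ-homo-neg (+ suc m ℤ.* j) ⟩
    - fromℤ (+ suc m ℤ.* j)         ≈⟨ -‿cong (fromℤ-homo-*-+ (suc m) j) ⟩
    - (suc m × 1# * fromℤ j)        ≈⟨ -‿distribˡ-* _ _ ⟩
    - (suc m × 1#) * fromℤ j        ∎

  private
    ℤ-rawRing : RawRing _ _
    ℤ-rawRing = record
      { Carrier = ℤ ; _≈_ = _≡_ ; _+_ = ℤ._+_ ; _*_ = ℤ._*_ ; -_ = ℤ.-_ ; 0# = ℤ.0ℤ ; 1# = ℤ.1ℤ }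

    homomorphism : ℤ-rawRing ACR.-Raw-AlmostCommutative⟶ ACR.fromCommutativeRing R
    homomorphism = record
      { ⟦_⟧ = fromℤ ; +-homo = fromℤ-homo-+ ; *-homo = fromℤ-homo-* ; -‿homo = fromℤ-homo-neg
      ; 0-homo = refl ; 1-homo = refl }

    fromℤ-equal? : ∀ i j → Maybe (fromℤ i ≈ fromℤ j)
    fromℤ-equal? i j with i ℤ.≟ j
    ... | yes ≡.refl = just refl
    ... | no _       = nothing

  open import Algebra.Solver.Ring ℤ-rawRing (ACR.fromCommutativeRing R) homomorphism fromℤ-equal?
    public using (solve; _:=_; _:+_; _:*_; :-_; con)

module Summation {c ℓ : Level} (R : CommutativeRing c ℓ) where
  open CommutativeRing R hiding (zero)
  open import Relation.Binary.Reasoning.Setoid setoid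
  open import Algebra.Properties.CommutativeSemigroup +-commutativeSemigroup using (interchange)

  sum : ℕ → (ℕ → Carrier) → Carrier
  sum zero    f = 0#
  sum (suc n) f = sum n f + f n

  prod : ℕ → (ℕ → Carrier) → Carrier
  prod zero    f = 1#
  prod (suc n) f = prod n f * f n

  sum-cong : ∀ n {f g : ℕ → Carrier} → (∀ i → i < n → f i ≈ g i) → sum n f ≈ sum n g
  sum-cong zero    f≈g = refl
  sum-cong (suc n) f≈g = +-cong (sum-cong n (λ i i<n → f≈g i (ℕ.m<n⇒m<1+n i<n))) (f≈g n ℕ.≤-refl)

  sum-cong′ : ∀ n {f g : ℕ → Carrier} → (∀ i → f i ≈ g i) → sum n f ≈ sum n g
  sum-cong′ n f≈g = sum-cong n (λ i _ → f≈g i)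

  sum-zero : ∀ n {f : ℕ → Carrier} → (∀ i → i < n → f i ≈ 0#) → sum n f ≈ 0#
  sum-zero zero    f≈0 = refl
  sum-zero (suc n) f≈0 =
    trans (+-cong (sum-zero n (λ i i<n → f≈0 i (ℕ.m<n⇒m<1+n i<n))) (f≈0 n ℕ.≤-refl)) (+-identityˡ _)

  sum-distrib-+ : ∀ n (f g : ℕ → Carrier) → sum n (λ i → f i + g i) ≈ sum n f + sum n g
  sum-distrib-+ zero    f g = sym (+-identityˡ _)
  sum-distrib-+ (suc n) f g = begin
    sum n (λ i → f i + g i) + (f n + g n) ≈⟨ +-congʳ (sum-distrib-+ n f g) ⟩
    (sum n f + sum n g) + (f n + g n)     ≈⟨ interchange _ _ _ _ ⟩
    (sum n f + f n) + (sum n g + g n)     ∎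

  *-distribˡ-sum : ∀ n a (f : ℕ → Carrier) → a * sum n f ≈ sum n (λ i → a * f i)
  *-distribˡ-sum zero    a f = zeroʳ a
  *-distribˡ-sum (suc n) a f = trans (distribˡ _ _ _) (+-congʳ (*-distribˡ-sum n a f))

  *-distribʳ-sum : ∀ n a (f : ℕ → Carrier) → sum n f * a ≈ sum n (λ i → f i * a)
  *-distribʳ-sum n a f = trans (*-comm _ _) (trans (*-distribˡ-sum n a f) (sum-cong′ n (λ i → *-comm _ _)))

  sum-unfoldˡ : ∀ n (f : ℕ → Carrier) → sum (suc n) f ≈ f 0 + sum n (λ i → f (suc i))
  sum-unfoldˡ zero    f = trans (+-identityˡ _) (sym (+-identityʳ _))
  sum-unfoldˡ (suc n) f = trans (+-congʳ (sum-unfoldˡ n f)) (+-assoc _ _ _)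

  sum-reverse : ∀ n (f : ℕ → Carrier) → sum (suc n) f ≈ sum (suc n) (λ i → f (n ∸ i))
  sum-reverse zero    f = refl
  sum-reverse (suc n) f = begin
    sum (suc n) f + f (suc n)                   ≈⟨ +-comm _ _ ⟩
    f (suc n) + sum (suc n) f                   ≈⟨ +-congˡ (sum-reverse n f) ⟩
    f (suc n) + sum (suc n) (λ i → f (n ∸ i))   ≈⟨ sym (sum-unfoldˡ (suc n) (λ i → f (suc n ∸ i))) ⟩
    sum (suc (suc n)) (λ i → f (suc n ∸ i))     ∎

  sum-single : ∀ n a (f : ℕ → Carrier) → a < n → (∀ i → ¬ i ≡ a → f i ≈ 0#) → sum n f ≈ f a
  sum-single (suc n) a f a<1+n f≈0 with a ℕ.≟ n
  ... | yes ≡.refl = trans (+-congʳ (sum-zero n (λ i i<n → f≈0 i (λ i≡n → ℕ.<-irrefl i≡n i<n)))) (+-identityˡ _)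
  ... | no a≢n     = trans (+-cong (sum-single n a f (ℕ.≤∧≢⇒< (ℕ.≤-pred a<1+n) a≢n) f≈0)
                                   (f≈0 n (λ n≡a → a≢n (≡.sym n≡a))))
                           (+-identityʳ _)

  sum-triangle : ∀ n (G : ℕ → ℕ → Carrier) →
    sum (suc n) (λ i → sum (suc i) (λ j → G j (i ∸ j))) ≈ sum (suc n) (λ j → sum (suc (n ∸ j)) (G j))
  sum-triangle zero    G = refl
  sum-triangle (suc n) G = begin
    sum (suc n) (λ i → sum (suc i) (λ j → G j (i ∸ j))) + (antidiagonal + G (suc n) (n ∸ n))
      ≈⟨ +-congʳ (sum-triangle n G) ⟩
    sum (suc n) (λ j → sum (suc (n ∸ j)) (G j)) + (antidiagonal + G (suc n) (n ∸ n))
      ≈⟨ sym (+-assoc _ _ _) ⟩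
    (sum (suc n) (λ j → sum (suc (n ∸ j)) (G j)) + antidiagonal) + G (suc n) (n ∸ n)
      ≈⟨ +-cong (sym (sum-distrib-+ (suc n) _ _)) (reflexive (≡.cong (G (suc n)) (ℕ.n∸n≡0 n))) ⟩
    sum (suc n) (λ j → sum (suc (n ∸ j)) (G j) + G j (suc n ∸ j)) + G (suc n) 0
      ≈⟨ +-cong (sum-cong (suc n) extend-row) (sym (+-identityˡ _)) ⟩
    sum (suc n) (λ j → sum (suc (suc n ∸ j)) (G j)) + sum 1 (G (suc n))
      ≈⟨ +-congˡ (reflexive (≡.cong (λ k → sum (suc k) (G (suc n))) (≡.sym (ℕ.n∸n≡0 n)))) ⟩
    sum (suc n) (λ j → sum (suc (suc n ∸ j)) (G j)) + sum (suc (suc n ∸ suc n)) (G (suc n)) ∎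
    where
    antidiagonal : Carrier
    antidiagonal = sum (suc n) (λ j → G j (suc n ∸ j))
    extend-row : ∀ j → j < suc n → sum (suc (n ∸ j)) (G j) + G j (suc n ∸ j) ≈ sum (suc (suc n ∸ j)) (G j)
    extend-row j j<1+n rewrite ℕ.+-∸-assoc 1 (ℕ.≤-pred j<1+n) = refl

  prod-cong : ∀ n {f g : ℕ → Carrier} → (∀ i → i < n → f i ≈ g i) → prod n f ≈ prod n g
  prod-cong zero    f≈g = refl
  prod-cong (suc n) f≈g = *-cong (prod-cong n (λ i i<n → f≈g i (ℕ.m<n⇒m<1+n i<n))) (f≈g n ℕ.≤-refl)

  prod-unfoldˡ : ∀ n (f : ℕ → Carrier) → prod (suc n) f ≈ f 0 * prod n (λ i → f (suc i))
  prod-unfoldˡ zero    f = trans (*-identityˡ _) (sym (*-identityʳ _))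
  prod-unfoldˡ (suc n) f = trans (*-congʳ (prod-unfoldˡ n f)) (*-assoc _ _ _)

  prod-split : ∀ m n (f : ℕ → Carrier) → prod (m ℕ.+ n) f ≈ prod m f * prod n (λ i → f (m ℕ.+ i))
  prod-split m zero    f = trans (reflexive (≡.cong (λ k → prod k f) (ℕ.+-identityʳ m))) (sym (*-identityʳ _))
  prod-split m (suc n) f = begin
    prod (m ℕ.+ suc n) f                             ≈⟨ reflexive (≡.cong (λ k → prod k f) (ℕ.+-suc m n)) ⟩
    prod (m ℕ.+ n) f * f (m ℕ.+ n)                   ≈⟨ *-congʳ (prod-split m n f) ⟩
    (prod m f * prod n (λ i → f (m ℕ.+ i))) * f (m ℕ.+ n) ≈⟨ *-assoc _ _ _ ⟩
    prod m f * prod (suc n) (λ i → f (m ℕ.+ i))      ∎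

module FormalPowerSeries {c ℓ : Level} (R : CommutativeRing c ℓ) where
  open CommutativeRing R hiding (zero)
  open import Relation.Binary.Reasoning.Setoid setoid
  open Summation R using (sum; sum-cong; sum-cong′; sum-zero; sum-distrib-+; *-distribˡ-sum; *-distribʳ-sum;
                          sum-unfoldˡ; sum-reverse; sum-single; sum-triangle)
  open import Algebra.Properties.Group +-group using (x∙y⁻¹≈ε⇒x≈y; x≈y⇒x∙y⁻¹≈ε)
  open import Algebra.Properties.Ring ring using (-0#≈0#)

  Series : Set c
  Series = ℕ → Carrier

  infix  4 _≋_
  infixl 6 _+ˢ_
  infixl 7 _*ˢ_

  -- Equality and the relations below are records, not Π-types, so that their indices can be inferred.
  record _≋_ (f g : Series) : Set ℓ where
    constructor coefficientwise
    field ≋-at : ∀ n → f n ≈ g n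
  open _≋_ public

  ≋-refl : ∀ {f} → f ≋ f
  ≋-refl = coefficientwise λ _ → refl

  0ˢ : Series
  0ˢ _ = 0#

  1ˢ : Series
  1ˢ zero    = 1#
  1ˢ (suc _) = 0#

  _+ˢ_ : Series → Series → Series
  (f +ˢ g) n = f n + g n

  -ˢ_ : Series → Series
  (-ˢ f) n = - f n

  _*ˢ_ : Series → Series → Series
  (f *ˢ g) n = sum (suc n) (λ i → f i * g (n ∸ i))

  *ˢ-cong : ∀ {f f′ g g′} → f ≋ f′ → g ≋ g′ → f *ˢ g ≋ f′ *ˢ g′
  *ˢ-cong f≋f′ g≋g′ = coefficientwise λ n →
    sum-cong′ (suc n) (λ i → *-cong (≋-at f≋f′ i) (≋-at g≋g′ (n ∸ i)))

  *ˢ-comm : ∀ f g → f *ˢ g ≋ g *ˢ f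
  *ˢ-comm f g = coefficientwise λ n → trans (sum-reverse n _) (sum-cong (suc n) λ i i<1+n →
    trans (*-congˡ (reflexive (≡.cong g (ℕ.m∸[m∸n]≡n (ℕ.≤-pred i<1+n))))) (*-comm _ _))

  *ˢ-identityˡ : ∀ f → 1ˢ *ˢ f ≋ f
  *ˢ-identityˡ f = coefficientwise λ n → begin
    (1ˢ *ˢ f) n                                    ≈⟨ sum-unfoldˡ n _ ⟩
    1# * f n + sum n (λ i → 0# * f (n ∸ suc i))   ≈⟨ +-cong (*-identityˡ _) (sum-zero n (λ i _ → zeroˡ _)) ⟩
    f n + 0#                                       ≈⟨ +-identityʳ _ ⟩
    f n                                            ∎

  *ˢ-distribˡ : ∀ f g h → f *ˢ (g +ˢ h) ≋ f *ˢ g +ˢ f *ˢ h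
  *ˢ-distribˡ f g h = coefficientwise λ n →
    trans (sum-cong′ (suc n) (λ i → distribˡ _ _ _)) (sum-distrib-+ (suc n) _ _)

  *ˢ-assoc : ∀ f g h → (f *ˢ g) *ˢ h ≋ f *ˢ (g *ˢ h)
  *ˢ-assoc f g h = coefficientwise λ n → begin
    sum (suc n) (λ i → (f *ˢ g) i * h (n ∸ i))
      ≈⟨ sum-cong′ (suc n) (λ i → *-distribʳ-sum (suc i) _ _) ⟩
    sum (suc n) (λ i → sum (suc i) (λ j → (f j * g (i ∸ j)) * h (n ∸ i)))
      ≈⟨ sum-cong (suc n) (λ i i<1+n → sum-cong (suc i) (λ j j<1+i →
           trans (*-assoc _ _ _) (*-congˡ (*-congˡ (reflexive (≡.cong h
             (∸-regroup n (ℕ.≤-pred j<1+i)))))))) ⟩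
    sum (suc n) (λ i → sum (suc i) (λ j → G n j (i ∸ j)))
      ≈⟨ sum-triangle n (G n) ⟩
    sum (suc n) (λ j → sum (suc (n ∸ j)) (G n j))
      ≈⟨ sum-cong′ (suc n) (λ j → sym (*-distribˡ-sum (suc (n ∸ j)) _ _)) ⟩
    sum (suc n) (λ j → f j * (g *ˢ h) (n ∸ j)) ∎
    where
    G : ℕ → ℕ → ℕ → Carrier
    G n j l = f j * (g l * h ((n ∸ j) ∸ l))
    ∸-regroup : ∀ n {i j} → j ≤ i → n ∸ i ≡ (n ∸ j) ∸ (i ∸ j)
    ∸-regroup n {i} {j} j≤i =
      ≡.trans (≡.cong (n ∸_) (≡.sym (ℕ.m+[n∸m]≡n j≤i))) (≡.sym (ℕ.∸-+-assoc n j (i ∸ j)))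

  seriesRing : CommutativeRing c ℓ
  seriesRing = record
    { Carrier = Series ; _≈_ = _≋_ ; _+_ = _+ˢ_ ; _*_ = _*ˢ_ ; -_ = -ˢ_ ; 0# = 0ˢ ; 1# = 1ˢ
    ; isCommutativeRing = record
      { isRing = record
        { +-isAbelianGroup = record
          { isGroup = record
            { isMonoid = record
              { isSemigroup = record
                { isMagma = record
                  { isEquivalence = record
                    { refl  = ≋-refl
                    ; sym   = λ p → coefficientwise λ n → sym (≋-at p n)
                    ; trans = λ p q → coefficientwise λ n → trans (≋-at p n) (≋-at q n) }
                  ; ∙-cong = λ p q → coefficientwise λ n → +-cong (≋-at p n) (≋-at q n) }
                ; assoc = λ _ _ _ → coefficientwise λ _ → +-assoc _ _ _ }
              ; identity = (λ _ → coefficientwise λ _ → +-identityˡ _) , (λ _ → coefficientwise λ _ → +-identityʳ _) }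
            ; inverse = (λ _ → coefficientwise λ _ → -‿inverseˡ _) , (λ _ → coefficientwise λ _ → -‿inverseʳ _)
            ; ⁻¹-cong = λ p → coefficientwise λ n → -‿cong (≋-at p n) }
          ; comm = λ _ _ → coefficientwise λ _ → +-comm _ _ }
        ; *-cong = *ˢ-cong
        ; *-assoc = *ˢ-assoc
        ; *-identity = *ˢ-identityˡ
                     , (λ f → coefficientwise λ n → trans (≋-at (*ˢ-comm f 1ˢ) n) (≋-at (*ˢ-identityˡ f) n))
        ; distrib = *ˢ-distribˡ
                  , (λ f g h → coefficientwise λ n → trans (≋-at (*ˢ-comm (g +ˢ h) f) n)
                       (trans (≋-at (*ˢ-distribˡ f g h) n) (+-cong (≋-at (*ˢ-comm f g) n) (≋-at (*ˢ-comm f h) n)))) }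
      ; *-comm = *ˢ-comm } }

  monomial : ℕ → Carrier → Series
  monomial a r n with n ℕ.≟ a
  ... | yes _ = r
  ... | no  _ = 0#

  monomial-at : ∀ a r → monomial a r a ≈ r
  monomial-at a r with a ℕ.≟ a
  ... | yes _  = refl
  ... | no a≢a = ⊥-elim (a≢a ≡.refl)

  monomial-off : ∀ a r {n} → ¬ n ≡ a → monomial a r n ≈ 0#
  monomial-off a r {n} n≢a with n ℕ.≟ a
  ... | yes n≡a = ⊥-elim (n≢a n≡a)
  ... | no  _   = refl

  monomial-cong : ∀ a {r s} → r ≈ s → monomial a r ≋ monomial a s
  monomial-cong a {r} {s} r≈s = coefficientwise coefficient
    where
    coefficient : ∀ n → monomial a r n ≈ monomial a s n
    coefficient n with n ℕ.≟ a
    ... | yes _ = r≈s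
    ... | no  _ = refl

  monomial-neg : ∀ a r → monomial a (- r) ≋ -ˢ monomial a r
  monomial-neg a r = coefficientwise coefficient
    where
    coefficient : ∀ n → monomial a (- r) n ≈ - monomial a r n
    coefficient n with n ℕ.≟ a
    ... | yes _ = refl
    ... | no  _ = sym -0#≈0#

  monomial-0-1 : monomial 0 1# ≋ 1ˢ
  monomial-0-1 = coefficientwise λ { zero → refl ; (suc n) → refl }

  monomial-* : ∀ a b r s → monomial a r *ˢ monomial b s ≋ monomial (a ℕ.+ b) (r * s)
  monomial-* a b r s = coefficientwise coefficient
    where
    coefficient : ∀ n → (monomial a r *ˢ monomial b s) n ≈ monomial (a ℕ.+ b) (r * s) n
    coefficient n with a ℕ.≤? n
    ... | no a≰n = trans
      (sum-zero (suc n) (λ i i<1+n → trans (*-congʳ (monomial-off a r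
        (λ i≡a → a≰n (≡.subst (ℕ._≤ n) i≡a (ℕ.≤-pred i<1+n))))) (zeroˡ _)))
      (sym (monomial-off (a ℕ.+ b) (r * s) (λ n≡a+b → a≰n (≡.subst (a ≤_) (≡.sym n≡a+b) (ℕ.m≤m+n a b)))))
    ... | yes a≤n = trans
      (sum-single (suc n) a _ (s≤s a≤n) (λ i i≢a → trans (*-congʳ (monomial-off a r i≢a)) (zeroˡ _)))
      (trans (*-congʳ (monomial-at a r)) remaining-factor)
      where
      remaining-factor : r * monomial b s (n ∸ a) ≈ monomial (a ℕ.+ b) (r * s) n
      remaining-factor with n ∸ a ℕ.≟ b | n ℕ.≟ a ℕ.+ b
      ... | yes _   | yes _   = refl
      ... | no  _   | no  _   = zeroʳ _
      ... | yes n∸a≡b | no n≢a+b  =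
        ⊥-elim (n≢a+b (≡.trans (≡.sym (ℕ.m+[n∸m]≡n a≤n)) (≡.cong (a ℕ.+_) n∸a≡b)))
      ... | no n∸a≢b  | yes n≡a+b =
        ⊥-elim (n∸a≢b (≡.trans (≡.cong (_∸ a) n≡a+b) (ℕ.m+n∸m≡n a b)))

  infix 4 X^_∣_ _≈[X^_]_

  record X^_∣_ (d : ℕ) (f : Series) : Set ℓ where
    constructor vanishes-below
    field vanishes : ∀ n → n < d → f n ≈ 0#
  open X^_∣_ public

  record _≈[X^_]_ (f : Series) (d : ℕ) (g : Series) : Set ℓ where
    constructor X^∣-difference
    field divides-difference : X^ d ∣ f +ˢ -ˢ g
  open _≈[X^_]_ public

  X^∣-resp-≋ : ∀ {d f g} → f ≋ g → X^ d ∣ f → X^ d ∣ g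
  X^∣-resp-≋ f≋g (vanishes-below f₀) = vanishes-below λ n n<d → trans (sym (≋-at f≋g n)) (f₀ n n<d)

  X^∣-weaken : ∀ {d d′ f} → d′ ≤ d → X^ d ∣ f → X^ d′ ∣ f
  X^∣-weaken d′≤d (vanishes-below f₀) = vanishes-below λ n n<d′ → f₀ n (ℕ.<-≤-trans n<d′ d′≤d)

  X^∣-+ : ∀ {d f g} → X^ d ∣ f → X^ d ∣ g → X^ d ∣ f +ˢ g
  X^∣-+ (vanishes-below f₀) (vanishes-below g₀) =
    vanishes-below λ n n<d → trans (+-cong (f₀ n n<d) (g₀ n n<d)) (+-identityˡ _)

  X^∣-neg : ∀ {d f} → X^ d ∣ f → X^ d ∣ -ˢ f
  X^∣-neg (vanishes-below f₀) =
    vanishes-below λ n n<d → trans (-‿cong (f₀ n n<d)) -0#≈0#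

  X^∣-* : ∀ {a b f g} → X^ a ∣ f → X^ b ∣ g → X^ (a ℕ.+ b) ∣ f *ˢ g
  X^∣-* {a} {b} {f} {g} (vanishes-below f₀) (vanishes-below g₀) = vanishes-below λ n n<a+b →
    sum-zero (suc n) (term n n<a+b)
    where
    term : ∀ n → n < a ℕ.+ b → ∀ i → i < suc n → f i * g (n ∸ i) ≈ 0#
    term n n<a+b i i<1+n with i ℕ.<? a
    ... | yes i<a = trans (*-congʳ (f₀ i i<a)) (zeroˡ _)
    ... | no  i≮a = trans (*-congˡ (g₀ (n ∸ i) (ℕ.≤-<-trans (ℕ.∸-monoʳ-≤ n a≤i) n∸a<b))) (zeroʳ _)
      where
      a≤i : a ≤ i
      a≤i = ℕ.≮⇒≥ i≮a
      n∸a<b : n ∸ a < b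
      n∸a<b = ℕ.+-cancelˡ-< a (n ∸ a) b
        (≡.subst (ℕ._< a ℕ.+ b) (≡.sym (ℕ.m+[n∸m]≡n (ℕ.≤-trans a≤i (ℕ.≤-pred i<1+n)))) n<a+b)

  X^∣-*ˡ : ∀ {d} f {g} → X^ d ∣ g → X^ d ∣ f *ˢ g
  X^∣-*ˡ f X^d∣g = X^∣-* {0} {f = f} (vanishes-below λ _ ()) X^d∣g

  X^∣-*ʳ : ∀ {d f} g → X^ d ∣ f → X^ d ∣ f *ˢ g
  X^∣-*ʳ {f = f} g X^d∣f = X^∣-resp-≋ (*ˢ-comm g f) (X^∣-*ˡ g X^d∣f)

  X^∣-monomial : ∀ a r → X^ a ∣ monomial a r
  X^∣-monomial a r = vanishes-below λ n n<a → monomial-off a r (λ n≡a → ℕ.<-irrefl n≡a n<a)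

  open IntegerCoefficientSolver seriesRing using (solve; _:=_; _:+_; _:*_; :-_; con)
  open Summation seriesRing using () renaming (sum to sumˢ; prod to prodˢ; prod-split to prodˢ-split)

  ≈[X^]⇒≈ : ∀ {d f g} → f ≈[X^ d ] g → ∀ n → n < d → f n ≈ g n
  ≈[X^]⇒≈ (X^∣-difference (vanishes-below f-g₀)) n n<d = x∙y⁻¹≈ε⇒x≈y _ _ (f-g₀ n n<d)

  ≈⇒≈[X^] : ∀ {d f g} → (∀ n → n < d → f n ≈ g n) → f ≈[X^ d ] g
  ≈⇒≈[X^] f≈g = X^∣-difference (vanishes-below λ n n<d → x≈y⇒x∙y⁻¹≈ε (f≈g n n<d))

  ≋⇒≈[X^] : ∀ {d f g} → f ≋ g → f ≈[X^ d ] g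
  ≋⇒≈[X^] f≋g = ≈⇒≈[X^] (λ n _ → ≋-at f≋g n)

  ≈[X^]-weaken : ∀ {d d′ f g} → d′ ≤ d → f ≈[X^ d ] g → f ≈[X^ d′ ] g
  ≈[X^]-weaken d′≤d (X^∣-difference f-g) = X^∣-difference (X^∣-weaken d′≤d f-g)

  ≈[X^]-sym : ∀ {d f g} → f ≈[X^ d ] g → g ≈[X^ d ] f
  ≈[X^]-sym {f = f} {g} (X^∣-difference f-g) = X^∣-difference (X^∣-resp-≋
    (solve 2 (λ f g → :- (f :+ :- g) := g :+ :- f) ≋-refl f g) (X^∣-neg f-g))

  ≈[X^]-trans : ∀ {d f g h} → f ≈[X^ d ] g → g ≈[X^ d ] h → f ≈[X^ d ] h
  ≈[X^]-trans {f = f} {g} {h} (X^∣-difference f-g) (X^∣-difference g-h) = X^∣-difference (X^∣-resp-≋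
    (solve 3 (λ f g h → (f :+ :- g) :+ (g :+ :- h) := f :+ :- h) ≋-refl f g h) (X^∣-+ f-g g-h))

  ≈[X^]-+ : ∀ {d f f′ g g′} → f ≈[X^ d ] f′ → g ≈[X^ d ] g′ → f +ˢ g ≈[X^ d ] f′ +ˢ g′
  ≈[X^]-+ {f = f} {f′} {g} {g′} (X^∣-difference f-f′) (X^∣-difference g-g′) = X^∣-difference (X^∣-resp-≋
    (solve 4 (λ f f′ g g′ → (f :+ :- f′) :+ (g :+ :- g′) := (f :+ g) :+ :- (f′ :+ g′)) ≋-refl f f′ g g′)
    (X^∣-+ f-f′ g-g′))

  ≈[X^]-* : ∀ {d f f′ g g′} → f ≈[X^ d ] f′ → g ≈[X^ d ] g′ → f *ˢ g ≈[X^ d ] f′ *ˢ g′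
  ≈[X^]-* {f = f} {f′} {g} {g′} (X^∣-difference f-f′) (X^∣-difference g-g′) = X^∣-difference (X^∣-resp-≋
    (solve 4 (λ f f′ g g′ → (f :+ :- f′) :* g :+ f′ :* (g :+ :- g′) := f :* g :+ :- (f′ :* g′)) ≋-refl f f′ g g′)
    (X^∣-+ (X^∣-*ʳ g f-f′) (X^∣-*ˡ f′ g-g′)))

  ≈[X^]-sum : ∀ {d} n {f g : ℕ → Series} → (∀ i → i < n → f i ≈[X^ d ] g i) → sumˢ n f ≈[X^ d ] sumˢ n g
  ≈[X^]-sum zero    f≈g = ≋⇒≈[X^] ≋-refl
  ≈[X^]-sum (suc n) f≈g = ≈[X^]-+ (≈[X^]-sum n (λ i i<n → f≈g i (ℕ.m<n⇒m<1+n i<n))) (f≈g n ℕ.≤-refl)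

  X^∣⇒+-≈[X^] : ∀ {d} f {g} → X^ d ∣ g → f +ˢ g ≈[X^ d ] f
  X^∣⇒+-≈[X^] f {g} X^d∣g = X^∣-difference (X^∣-resp-≋ (solve 2 (λ f g → g := (f :+ g) :+ :- f) ≋-refl f g) X^d∣g)

  prod-1-≈[X^]-1 : ∀ {d} n (g : ℕ → Series) → (∀ i → X^ d ∣ g i) → prodˢ n (λ i → 1ˢ +ˢ -ˢ g i) ≈[X^ d ] 1ˢ
  prod-1-≈[X^]-1 zero    g X^d∣g = ≋⇒≈[X^] ≋-refl
  prod-1-≈[X^]-1 (suc n) g X^d∣g = X^∣-difference (X^∣-resp-≋
    (solve 2 (λ p a → (p :+ :- con 1ℤ) :* (con 1ℤ :+ :- a) :+ :- a := p :* (con 1ℤ :+ :- a) :+ :- con 1ℤ)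
      ≋-refl (prodˢ n (λ i → 1ˢ +ˢ -ˢ g i)) (g n))
    (X^∣-+ (X^∣-*ʳ (1ˢ +ˢ -ˢ g n) (divides-difference (prod-1-≈[X^]-1 n g X^d∣g))) (X^∣-neg (X^d∣g n))))

  prod-truncate : ∀ {d} K L (g : ℕ → Series) → (∀ i → X^ d ∣ g (K ℕ.+ i)) →
    prodˢ (K ℕ.+ L) (λ i → 1ˢ +ˢ -ˢ g i) ≈[X^ d ] prodˢ K (λ i → 1ˢ +ˢ -ˢ g i)
  prod-truncate K L g X^d∣tail = X^∣-difference (X^∣-resp-≋ factored
    (X^∣-*ˡ head (divides-difference (prod-1-≈[X^]-1 L (λ i → g (K ℕ.+ i)) X^d∣tail))))
    where
    head = prodˢ K (λ i → 1ˢ +ˢ -ˢ g i)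
    tail = prodˢ L (λ i → 1ˢ +ˢ -ˢ g (K ℕ.+ i))
    factored : head *ˢ (tail +ˢ -ˢ 1ˢ) ≋ prodˢ (K ℕ.+ L) (λ i → 1ˢ +ˢ -ˢ g i) +ˢ -ˢ head
    factored = coefficientwise λ n → sym (trans (+-congʳ (≋-at (prodˢ-split K L (λ i → 1ˢ +ˢ -ˢ g i)) n))
      (≋-at (solve 2 (λ p q → p :* q :+ :- p := p :* (q :+ :- con 1ℤ)) ≋-refl head tail) n))

module Inverses {c ℓ : Level} (R : CommutativeRing c ℓ) where
  open CommutativeRing R
  open import Relation.Binary.Reasoning.Setoid setoid
  open IntegerCoefficientSolver R using (solve; _:=_; _:+_; _:*_; :-_; con)

  quotient-by-factor : ∀ {a a⁻¹ b b⁻¹ r} → a * a⁻¹ ≈ 1# → b * b⁻¹ ≈ 1# → b ≈ a * r → r * b⁻¹ ≈ a⁻¹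
  quotient-by-factor {a} {a⁻¹} {b} {b⁻¹} {r} aa⁻¹≈1 bb⁻¹≈1 b≈ar = sym (begin
    a⁻¹                   ≈⟨ sym (*-identityʳ a⁻¹) ⟩
    a⁻¹ * 1#              ≈⟨ *-congˡ (sym bb⁻¹≈1) ⟩
    a⁻¹ * (b * b⁻¹)       ≈⟨ *-congˡ (*-congʳ b≈ar) ⟩
    a⁻¹ * ((a * r) * b⁻¹)
      ≈⟨ solve 4 (λ a a⁻¹ r b⁻¹ → a⁻¹ :* ((a :* r) :* b⁻¹) := (a :* a⁻¹) :* (r :* b⁻¹)) refl a a⁻¹ r b⁻¹ ⟩
    (a * a⁻¹) * (r * b⁻¹) ≈⟨ *-congʳ aa⁻¹≈1 ⟩
    1# * (r * b⁻¹)        ≈⟨ *-identityˡ _ ⟩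
    r * b⁻¹               ∎)

  inverse-difference : ∀ {a a⁻¹ b b⁻¹} → a * a⁻¹ ≈ 1# → b * b⁻¹ ≈ 1# →
    a⁻¹ + - b⁻¹ ≈ (a⁻¹ * b⁻¹) * (b + - a)
  inverse-difference {a} {a⁻¹} {b} {b⁻¹} aa⁻¹≈1 bb⁻¹≈1 = sym (begin
    (a⁻¹ * b⁻¹) * (b + - a)
      ≈⟨ solve 4 (λ a a⁻¹ b b⁻¹ → (a⁻¹ :* b⁻¹) :* (b :+ :- a) := a⁻¹ :* (b :* b⁻¹) :+ :- (b⁻¹ :* (a :* a⁻¹)))
           refl a a⁻¹ b b⁻¹ ⟩
    a⁻¹ * (b * b⁻¹) + - (b⁻¹ * (a * a⁻¹)) ≈⟨ +-cong (*-congˡ bb⁻¹≈1) (-‿cong (*-congˡ aa⁻¹≈1)) ⟩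
    a⁻¹ * 1# + - (b⁻¹ * 1#)               ≈⟨ +-cong (*-identityʳ a⁻¹) (-‿cong (*-identityʳ b⁻¹)) ⟩
    a⁻¹ + - b⁻¹                           ∎)

triangular : ℕ → ℕ
triangular zero    = 0
triangular (suc n) = triangular n ℕ.+ suc n

module QIdentities {c ℓ : Level} (R : CommutativeRing c ℓ) (x : CommutativeRing.Carrier R) where
  open CommutativeRing R hiding (zero)
  open import Relation.Binary.Reasoning.Setoid setoid
  open import Algebra.Properties.Ring ring using (-‿involutive; -‿distribˡ-*)
  open Summation R
  open IntegerCoefficientSolver R using (solve; _:=_; _:+_; _:*_; :-_; con)

  x^_ : ℕ → Carrier
  x^ zero  = 1#
  x^ suc n = x * x^ n

  x^-+ : ∀ m n → x^ (m ℕ.+ n) ≈ x^ m * x^ n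
  x^-+ zero    n = sym (*-identityˡ _)
  x^-+ (suc m) n = trans (*-congˡ (x^-+ m n)) (sym (*-assoc _ _ _))

  x^-cong : ∀ {m n} → m ≡ n → x^ m ≈ x^ n
  x^-cong m≡n = reflexive (≡.cong x^_ m≡n)

  qPoch : Carrier → ℕ → Carrier
  qPoch a n = prod n (λ j → 1# + - (a * x^ j))

  qPoch-cong : ∀ {a b} n → a ≈ b → qPoch a n ≈ qPoch b n
  qPoch-cong n a≈b = prod-cong n (λ j _ → +-congˡ (-‿cong (*-congʳ a≈b)))

  qPoch-unfoldˡ : ∀ a n → qPoch a (suc n) ≈ (1# + - a) * qPoch (a * x) n
  qPoch-unfoldˡ a n = trans (prod-unfoldˡ n _)
    (*-cong (+-congˡ (-‿cong (*-identityʳ a))) (prod-cong n (λ j _ → +-congˡ (-‿cong (sym (*-assoc _ _ _))))))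

  qPoch-+ : ∀ a m n → qPoch a (m ℕ.+ n) ≈ qPoch a m * qPoch (a * x^ m) n
  qPoch-+ a m n = trans (prod-split m n _)
    (*-congˡ (prod-cong n (λ j _ → +-congˡ (-‿cong (trans (*-congˡ (x^-+ m j)) (sym (*-assoc _ _ _)))))))

  qBinomial : ℕ → ℕ → Carrier
  qBinomial _       zero    = 1#
  qBinomial zero    (suc k) = 0#
  qBinomial (suc N) (suc k) = qBinomial N (suc k) + x^ (N ∸ k) * qBinomial N k

  qBinomial-above : ∀ N k → N < k → qBinomial N k ≈ 0#
  qBinomial-above zero    (suc k) _         = refl
  qBinomial-above (suc N) (suc k) (s≤s N<k) = begin
    qBinomial N (suc k) + x^ (N ∸ k) * qBinomial N k
      ≈⟨ +-cong (qBinomial-above N (suc k) (ℕ.m<n⇒m<1+n N<k)) (*-congˡ (qBinomial-above N k N<k)) ⟩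
    0# + x^ (N ∸ k) * 0#   ≈⟨ trans (+-identityˡ _) (zeroʳ _) ⟩
    0#                     ∎

  qBinomial-diagonal : ∀ N → qBinomial N N ≈ 1#
  qBinomial-diagonal zero    = refl
  qBinomial-diagonal (suc N) = begin
    qBinomial N (suc N) + x^ (N ∸ N) * qBinomial N N
      ≈⟨ +-cong (qBinomial-above N (suc N) ℕ.≤-refl) (*-cong (x^-cong (ℕ.n∸n≡0 N)) (qBinomial-diagonal N)) ⟩
    0# + 1# * 1#  ≈⟨ trans (+-identityˡ _) (*-identityˡ _) ⟩
    1#            ∎

  qPoch-neg-unfoldˡ : ∀ a n → qPoch (- a) (suc n) ≈ (1# + a) * qPoch (- (a * x)) n
  qPoch-neg-unfoldˡ a n =
    trans (qPoch-unfoldˡ (- a) n) (*-cong (+-congˡ (-‿involutive a)) (qPoch-cong n (sym (-‿distribˡ-* a x))))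

  qPoch-extendʳ : ∀ a {n} N → n ≤ N →
    qPoch (a * x^ suc n) (suc N ∸ n) ≈ qPoch (a * x^ suc n) (N ∸ n) * (1# + - (a * x^ suc N))
  qPoch-extendʳ a {n} N n≤N rewrite ℕ.+-∸-assoc 1 n≤N = *-congˡ (+-congˡ (-‿cong (begin
    (a * x^ suc n) * x^ (N ∸ n)  ≈⟨ *-assoc _ _ _ ⟩
    a * (x^ suc n * x^ (N ∸ n))  ≈⟨ *-congˡ (sym (x^-+ (suc n) (N ∸ n))) ⟩
    a * x^ (suc n ℕ.+ (N ∸ n))   ≈⟨ *-congˡ (x^-cong (≡.cong suc (ℕ.m+[n∸m]≡n n≤N))) ⟩
    a * x^ suc N                 ∎)))

  finiteTerm : ℕ → Carrier → ℕ → Carrier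
  finiteTerm N a n = x^ triangular n * qBinomial N n * qPoch (- a) n * qPoch (a * x^ suc n) (N ∸ n)

  -- The x^(N-n)-part of the q-Pascal rule, once x^(n+1) and the first factor (1 + a) are pulled out,
  -- is the term of index n for the parameter a x.
  finiteTerm-shift : ∀ N a n → n ≤ N →
    x^ triangular (suc n) * (x^ (N ∸ n) * qBinomial N n) * qPoch (- a) (suc n) * qPoch (a * x^ suc (suc n)) (N ∸ n)
      ≈ (x^ suc N * (1# + a)) * finiteTerm N (a * x) n
  finiteTerm-shift N a n n≤N = begin
    x^ triangular (suc n) * (x^ (N ∸ n) * qBinomial N n) * qPoch (- a) (suc n) * qPoch (a * x^ suc (suc n)) (N ∸ n)
      ≈⟨ *-cong (*-cong (*-congʳ (x^-+ (triangular n) (suc n))) (qPoch-neg-unfoldˡ a n))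
                (qPoch-cong (N ∸ n) (sym (*-assoc a x (x^ suc n)))) ⟩
    τ * x^ suc n * (x^ (N ∸ n) * B) * ((1# + a) * P) * Q
      ≈⟨ solve 7 (λ τ p₁ p₂ B A P Q → τ :* p₁ :* (p₂ :* B) :* (A :* P) :* Q := (p₁ :* p₂) :* A :* (τ :* B :* P :* Q))
           refl τ (x^ suc n) (x^ (N ∸ n)) B (1# + a) P Q ⟩
    (x^ suc n * x^ (N ∸ n)) * (1# + a) * finiteTerm N (a * x) n
      ≈⟨ *-congʳ (*-congʳ (trans (sym (x^-+ (suc n) (N ∸ n))) (x^-cong (≡.cong suc (ℕ.m+[n∸m]≡n n≤N))))) ⟩
    x^ suc N * (1# + a) * finiteTerm N (a * x) n ∎
    where
    τ = x^ triangular n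
    B = qBinomial N n
    P = qPoch (- (a * x)) n
    Q = qPoch ((a * x) * x^ suc n) (N ∸ n)

  -- Induction on N: the q-Pascal rule splits the sum into the sum for (N, a), times 1 - a x^(N+1),
  -- plus the sum for (N, a x), times x^(N+1) (1 + a).
  finite-identity : ∀ N a → sum (suc N) (finiteTerm N a) ≈ qPoch (- x) N
  finite-identity zero    a = trans (+-identityˡ _) (trans (*-identityʳ _) (trans (*-identityʳ _) (*-identityʳ _)))
  finite-identity (suc N) a = begin
    sum (suc (suc N)) (finiteTerm (suc N) a)
      ≈⟨ sum-unfoldˡ (suc N) _ ⟩
    G 0 + sum (suc N) (λ n → finiteTerm (suc N) a (suc n))
      ≈⟨ +-congˡ (trans (sum-cong′ (suc N) (λ n → pascal-split n)) (sum-distrib-+ (suc N) _ _)) ⟩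
    G 0 + (sum (suc N) (λ n → G (suc n)) + sum (suc N) shifted)
      ≈⟨ sym (+-assoc _ _ _) ⟩
    (G 0 + sum (suc N) (λ n → G (suc n))) + sum (suc N) shifted
      ≈⟨ +-cong (sym (sum-unfoldˡ (suc N) G))
                (sum-cong (suc N) (λ n n<1+N → finiteTerm-shift N a n (ℕ.≤-pred n<1+N))) ⟩
    (sum (suc N) G + G (suc N)) + sum (suc N) (λ n → (x^ suc N * (1# + a)) * finiteTerm N (a * x) n)
      ≈⟨ +-cong (trans (+-congˡ G-last) (+-identityʳ _)) (sym (*-distribˡ-sum (suc N) _ _)) ⟩
    sum (suc N) G + (x^ suc N * (1# + a)) * sum (suc N) (finiteTerm N (a * x))
      ≈⟨ +-congʳ (trans (sum-cong (suc N) (λ n n<1+N → G-extend n (ℕ.≤-pred n<1+N))) (sym (*-distribʳ-sum (suc N) _ _))) ⟩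
    sum (suc N) (finiteTerm N a) * (1# + - (a * x^ suc N)) + (x^ suc N * (1# + a)) * sum (suc N) (finiteTerm N (a * x))
      ≈⟨ +-cong (*-congʳ (finite-identity N a)) (*-congˡ (finite-identity N (a * x))) ⟩
    E * (1# + - (a * x^ suc N)) + (x^ suc N * (1# + a)) * E
      ≈⟨ solve 4 (λ E x y a → E :* (con 1ℤ :+ :- (a :* (x :* y))) :+ ((x :* y) :* (con 1ℤ :+ a)) :* E
                              := E :* (con 1ℤ :+ :- (:- x :* y)))
           refl E x (x^ N) a ⟩
    qPoch (- x) (suc N) ∎
    where
    E = qPoch (- x) N
    G : ℕ → Carrier
    G n = x^ triangular n * qBinomial N n * qPoch (- a) n * qPoch (a * x^ suc n) (suc N ∸ n)
    shifted : ℕ → Carrier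
    shifted n = x^ triangular (suc n) * (x^ (N ∸ n) * qBinomial N n) * qPoch (- a) (suc n) * qPoch (a * x^ suc (suc n)) (N ∸ n)
    pascal-split : ∀ n → finiteTerm (suc N) a (suc n) ≈ G (suc n) + shifted n
    pascal-split n = trans (*-congʳ (*-congʳ (distribˡ _ _ _))) (trans (*-congʳ (distribʳ _ _ _)) (distribʳ _ _ _))
    G-last : G (suc N) ≈ 0#
    G-last = trans (*-congʳ (*-congʳ (trans (*-congˡ (qBinomial-above N (suc N) ℕ.≤-refl)) (zeroʳ _))))
                   (trans (*-congʳ (zeroˡ _)) (zeroˡ _))
    G-extend : ∀ n → n ≤ N → G n ≈ finiteTerm N a n * (1# + - (a * x^ suc N))
    G-extend n n≤N = trans (*-congˡ (qPoch-extendʳ a N n≤N)) (sym (*-assoc _ _ _))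

  qBinomial-qPoch : ∀ n N → qBinomial (n ℕ.+ N) n * qPoch x n * qPoch x N ≈ qPoch x (n ℕ.+ N)
  qBinomial-qPoch zero    N = trans (*-congʳ (*-identityʳ _)) (*-identityˡ _)
  qBinomial-qPoch (suc n) zero = begin
    qBinomial (suc n ℕ.+ 0) (suc n) * qPoch x (suc n) * 1#
      ≈⟨ trans (*-identityʳ _) (*-congʳ (reflexive (≡.cong (λ k → qBinomial k (suc n)) (ℕ.+-identityʳ (suc n))))) ⟩
    qBinomial (suc n) (suc n) * qPoch x (suc n)
      ≈⟨ trans (*-congʳ (qBinomial-diagonal (suc n))) (*-identityˡ _) ⟩
    qPoch x (suc n)
      ≈⟨ reflexive (≡.cong (qPoch x) (≡.sym (ℕ.+-identityʳ (suc n)))) ⟩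
    qPoch x (suc n ℕ.+ 0) ∎
  qBinomial-qPoch (suc n) (suc N) = begin
    (qBinomial M (suc n) + x^ (M ∸ n) * qBinomial M n) * (Qn * (1# + - x^ suc n)) * (QN * (1# + - x^ suc N))
      ≈⟨ *-congʳ (*-congʳ (+-cong (reflexive (≡.cong (λ k → qBinomial k (suc n)) (ℕ.+-suc n N)))
                                  (*-congʳ (x^-cong (ℕ.m+n∸m≡n n (suc N)))))) ⟩
    (qBinomial (suc n ℕ.+ N) (suc n) + x^ suc N * qBinomial M n) * (Qn * (1# + - x^ suc n)) * (QN * (1# + - x^ suc N))
      ≈⟨ solve 7 (λ B₁ p B₂ a b c d → (B₁ :+ p :* B₂) :* (a :* b) :* (c :* d)
                                    := (B₁ :* (a :* b) :* c) :* d :+ p :* b :* (B₂ :* a :* (c :* d)))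
           refl (qBinomial (suc n ℕ.+ N) (suc n)) (x^ suc N) (qBinomial M n) Qn (1# + - x^ suc n) QN (1# + - x^ suc N) ⟩
    (qBinomial (suc n ℕ.+ N) (suc n) * qPoch x (suc n) * QN) * (1# + - x^ suc N)
      + x^ suc N * (1# + - x^ suc n) * (qBinomial M n * Qn * qPoch x (suc N))
      ≈⟨ +-cong (*-congʳ (trans (qBinomial-qPoch (suc n) N) (reflexive (≡.cong (qPoch x) (≡.sym (ℕ.+-suc n N))))))
                (*-congˡ (qBinomial-qPoch n (suc N))) ⟩
    QM * (1# + - x^ suc N) + x^ suc N * (1# + - x^ suc n) * QM
      ≈⟨ solve 3 (λ m p₁ p₂ → m :* (con 1ℤ :+ :- p₁) :+ p₁ :* (con 1ℤ :+ :- p₂) :* m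
                            := m :* (con 1ℤ :+ :- (p₂ :* p₁)))
           refl QM (x^ suc N) (x^ suc n) ⟩
    QM * (1# + - (x^ suc n * x^ suc N))
      ≈⟨ *-congˡ (+-congˡ (-‿cong (sym (x^-+ (suc n) (suc N))))) ⟩
    qPoch x (suc n ℕ.+ suc N) ∎
    where
    M = n ℕ.+ suc N
    Qn = qPoch x n
    QN = qPoch x N
    QM = qPoch x M

  open Inverses R

  finite-identity-divided : ∀ a (a⁻¹ : ℕ → Carrier) → (∀ k → qPoch a k * a⁻¹ k ≈ 1#) → ∀ N →
    sum (suc N) (λ n → x^ triangular n * qBinomial N n * qPoch (- a) n * a⁻¹ (suc n)) ≈ qPoch (- x) N * a⁻¹ (suc N)
  finite-identity-divided a a⁻¹ inverse N = begin
    sum (suc N) (λ n → x^ triangular n * qBinomial N n * qPoch (- a) n * a⁻¹ (suc n))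
      ≈⟨ sum-cong (suc N) (λ n n<1+N → sym (divide-term n (ℕ.≤-pred n<1+N))) ⟩
    sum (suc N) (λ n → finiteTerm N a n * a⁻¹ (suc N))
      ≈⟨ sym (*-distribʳ-sum (suc N) _ _) ⟩
    sum (suc N) (finiteTerm N a) * a⁻¹ (suc N)
      ≈⟨ *-congʳ (finite-identity N a) ⟩
    qPoch (- x) N * a⁻¹ (suc N) ∎
    where
    divide-term : ∀ n → n ≤ N →
      finiteTerm N a n * a⁻¹ (suc N) ≈ x^ triangular n * qBinomial N n * qPoch (- a) n * a⁻¹ (suc n)
    divide-term n n≤N = trans (*-assoc _ _ _) (*-congˡ (quotient-by-factor (inverse (suc n)) (inverse (suc N))
      (trans (reflexive (≡.cong (qPoch a) (≡.sym (≡.cong suc (ℕ.m+[n∸m]≡n n≤N))))) (qPoch-+ a (suc n) (N ∸ n)))))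

  qBinomial-sub-inverse : ∀ (q⁻¹ : ℕ → Carrier) → (∀ k → qPoch x k * q⁻¹ k ≈ 1#) → ∀ {n} N → n ≤ N →
    qBinomial N n + - q⁻¹ n ≈ q⁻¹ n * (qPoch (x^ suc (N ∸ n)) n + - 1#)
  qBinomial-sub-inverse q⁻¹ inverse {n} N n≤N = begin
    B + - q⁻¹ n                          ≈⟨ +-congʳ B≈r/Qn ⟩
    r * q⁻¹ n + - q⁻¹ n                  ≈⟨ solve 2 (λ r i → r :* i :+ :- i := i :* (r :+ :- con 1ℤ)) refl r (q⁻¹ n) ⟩
    q⁻¹ n * (r + - 1#)                   ∎
    where
    m = N ∸ n
    B = qBinomial N n
    r = qPoch (x^ suc m) n
    BQnQm≈Qmr : B * qPoch x n * qPoch x m ≈ qPoch x m * r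
    BQnQm≈Qmr = begin
      B * qPoch x n * qPoch x m
        ≈⟨ *-congʳ (*-congʳ (reflexive (≡.cong (λ k → qBinomial k n) (≡.sym (ℕ.m+[n∸m]≡n n≤N))))) ⟩
      qBinomial (n ℕ.+ m) n * qPoch x n * qPoch x m ≈⟨ qBinomial-qPoch n m ⟩
      qPoch x (n ℕ.+ m)                           ≈⟨ reflexive (≡.cong (qPoch x) (ℕ.+-comm n m)) ⟩
      qPoch x (m ℕ.+ n)                           ≈⟨ qPoch-+ x m n ⟩
      qPoch x m * r                               ∎
    B≈r/Qn : B ≈ r * q⁻¹ n
    B≈r/Qn = begin
      B
        ≈⟨ sym (trans (*-congˡ (*-cong (inverse n) (inverse m))) (trans (*-congˡ (*-identityʳ 1#)) (*-identityʳ B))) ⟩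
      B * ((qPoch x n * q⁻¹ n) * (qPoch x m * q⁻¹ m))
        ≈⟨ solve 5 (λ B a a⁻¹ b b⁻¹ → B :* ((a :* a⁻¹) :* (b :* b⁻¹)) := (B :* a :* b) :* (a⁻¹ :* b⁻¹))
             refl B (qPoch x n) (q⁻¹ n) (qPoch x m) (q⁻¹ m) ⟩
      (B * qPoch x n * qPoch x m) * (q⁻¹ n * q⁻¹ m)
        ≈⟨ *-congʳ BQnQm≈Qmr ⟩
      (qPoch x m * r) * (q⁻¹ n * q⁻¹ m)
        ≈⟨ solve 4 (λ b r a⁻¹ b⁻¹ → (b :* r) :* (a⁻¹ :* b⁻¹) := (b :* b⁻¹) :* (r :* a⁻¹))
             refl (qPoch x m) r (q⁻¹ n) (q⁻¹ m) ⟩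
      (qPoch x m * q⁻¹ m) * (r * q⁻¹ n)
        ≈⟨ trans (*-congʳ (inverse m)) (*-identityˡ _) ⟩
      r * q⁻¹ n ∎

module InT = FormalPowerSeries ℤ.+-*-commutativeRing
module InQ = FormalPowerSeries InT.seriesRing
module ΣT  = Summation InT.seriesRing

ℤ[[t]][[q]] : CommutativeRing _ _
ℤ[[t]][[q]] = InQ.seriesRing

open CommutativeRing ℤ[[t]][[q]] hiding (zero)

Σ<-cong : ∀ n {h h′ : ℕ → ℤ} → (∀ i → h i ≡ h′ i) → Σ< n h ≡ Σ< n h′
Σ<-cong zero    h≡h′ = ≡.refl
Σ<-cong (suc n) h≡h′ = ≡.cong₂ ℤ._+_ (Σ<-cong n h≡h′) (h≡h′ n)

Σ<≡sum : ∀ n h → Σ< n h ≡ Summation.sum ℤ.+-*-commutativeRing n h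
Σ<≡sum zero    h = ≡.refl
Σ<≡sum (suc n) h = ≡.cong (ℤ._+ h n) (Σ<≡sum n h)

ΣT-sum-at : ∀ n (H : ℕ → T) k → ΣT.sum n H k ≡ Σ< n (λ i → H i k)
ΣT-sum-at zero    H k = ≡.refl
ΣT-sum-at (suc n) H k = ≡.cong (ℤ._+ H n k) (ΣT-sum-at n H k)

*T≡*ˢ : ∀ f g k → (f *T g) k ≡ (f InT.*ˢ g) k
*T≡*ˢ f g k = Σ<≡sum (suc k) _

coefficientwise′ : ∀ {f g : S} → (∀ m k → f m k ≡ g m k) → f ≈ g
coefficientwise′ f≡g = InQ.coefficientwise λ m → InT.coefficientwise (f≡g m)

coefficient-at : ∀ {f g : S} → f ≈ g → ∀ m k → f m k ≡ g m k
coefficient-at f≈g m = InT.≋-at (InQ.≋-at f≈g m)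

*S≈* : ∀ f g → f *S g ≈ f * g
*S≈* f g = coefficientwise′ λ m k → ≡.trans (Σ<-cong (suc m) (λ i → *T≡*ˢ (f i) (g (m ∸ i)) k))
                                           (≡.sym (ΣT-sum-at (suc m) (λ i → f i InT.*ˢ g (m ∸ i)) k))

+S≈+ : ∀ f g → f +S g ≈ f + g
+S≈+ f g = refl

1S≈1 : 1S ≈ 1#
1S≈1 = coefficientwise′ λ { zero zero → ≡.refl ; zero (suc k) → ≡.refl ; (suc m) k → ≡.refl }

mono≈monomial : ∀ c a b → mono c a b ≈ InQ.monomial a (InT.monomial b c)
mono≈monomial c a b = coefficientwise′ coefficient
  where
  coefficient : ∀ m k → mono c a b m k ≡ InQ.monomial a (InT.monomial b c) m k
  coefficient m k with m ℕ.≟ a | k ℕ.≟ b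
  ... | yes ≡.refl | yes ≡.refl = ≡.sym (InT.monomial-at b c)
  ... | yes ≡.refl | no k≢b     = ≡.sym (InT.monomial-off b c k≢b)
  ... | no _       | _          = ≡.refl

module Tᵣ = CommutativeRing InT.seriesRing

oneMinus≈ : ∀ c a b → oneMinus c a b ≈ 1# + - mono c a b
oneMinus≈ c a b = coefficientwise′ λ m k → ≡.cong (ℤ._+ ℤ.- mono c a b m k) (coefficient-at 1S≈1 m k)

x : S
x = mono 1ℤ 2 0

open QIdentities ℤ[[t]][[q]] x

1ᵗ : T
1ᵗ = InT.monomial 0 1ℤ

x^≈monomial : ∀ j → x^ j ≈ InQ.monomial (2 ℕ.* j) 1ᵗ
x^≈monomial zero    = sym (trans (InQ.monomial-cong 0 InT.monomial-0-1) InQ.monomial-0-1)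
x^≈monomial (suc j) = begin
  x * x^ j                                              ≈⟨ *-cong (mono≈monomial 1ℤ 2 0) (x^≈monomial j) ⟩
  InQ.monomial 2 1ᵗ * InQ.monomial (2 ℕ.* j) 1ᵗ         ≈⟨ InQ.monomial-* 2 (2 ℕ.* j) 1ᵗ 1ᵗ ⟩
  InQ.monomial (2 ℕ.+ 2 ℕ.* j) (1ᵗ Tᵣ.* 1ᵗ)             ≈⟨ InQ.monomial-cong _ (InT.monomial-* 0 0 1ℤ 1ℤ) ⟩
  InQ.monomial (2 ℕ.+ 2 ℕ.* j) 1ᵗ                       ≈⟨ reflexive (≡.cong (λ i → InQ.monomial i 1ᵗ) (ℕ.*-suc 2 j)) ⟨
  InQ.monomial (2 ℕ.* suc j) 1ᵗ                         ∎
  where open import Relation.Binary.Reasoning.Setoid setoid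

mono-shift : ∀ c d e j → mono c d e * x^ j ≈ mono c (d ℕ.+ 2 ℕ.* j) e
mono-shift c d e j = begin
  mono c d e * x^ j                                     ≈⟨ *-cong (mono≈monomial c d e) (x^≈monomial j) ⟩
  InQ.monomial d M * InQ.monomial (2 ℕ.* j) 1ᵗ          ≈⟨ InQ.monomial-* d (2 ℕ.* j) M 1ᵗ ⟩
  InQ.monomial (d ℕ.+ 2 ℕ.* j) (M Tᵣ.* 1ᵗ)
    ≈⟨ InQ.monomial-cong (d ℕ.+ 2 ℕ.* j) (Tᵣ.trans (Tᵣ.*-congˡ {M} InT.monomial-0-1) (Tᵣ.*-identityʳ M)) ⟩
  InQ.monomial (d ℕ.+ 2 ℕ.* j) M                        ≈⟨ sym (mono≈monomial c (d ℕ.+ 2 ℕ.* j) e) ⟩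
  mono c (d ℕ.+ 2 ℕ.* j) e                              ∎
  where
  open import Relation.Binary.Reasoning.Setoid setoid
  M = InT.monomial e c

poch≈qPoch : ∀ c d e n → poch c d e 2 n ≈ qPoch (mono c d e) n
poch≈qPoch c d e zero    = 1S≈1
poch≈qPoch c d e (suc n) = trans (*S≈* (poch c d e 2 n) (oneMinus c (d ℕ.+ 2 ℕ.* n) e))
  (*-cong (poch≈qPoch c d e n)
          (trans (oneMinus≈ c (d ℕ.+ 2 ℕ.* n) e) (+-congˡ {1#} (-‿cong (sym (mono-shift c d e n))))))

lookup-invVec : ∀ f m (i : Fin (suc m)) → lookup (invVec f m) i ≡ inv f (m ∸ toℕ i)
lookup-invVec f zero    Fin.zero    = ≡.refl
lookup-invVec f (suc m) Fin.zero    = ≡.refl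
lookup-invVec f (suc m) (Fin.suc i) = lookup-invVec f m i

ΣFinT≈sum : ∀ n (h : Fin n → T) (F : ℕ → T) → (∀ i → h i Tᵣ.≈ F (toℕ i)) → ΣFinT n h Tᵣ.≈ ΣT.sum n F
ΣFinT≈sum zero    h F h≈F = Tᵣ.refl
ΣFinT≈sum (suc n) h F h≈F = Tᵣ.trans
  (Tᵣ.+-cong (h≈F Fin.zero) (ΣFinT≈sum n (λ i → h (Fin.suc i)) (λ i → F (suc i)) (λ i → h≈F (Fin.suc i))))
  (Tᵣ.sym (ΣT.sum-unfoldˡ n F))

inv-suc : ∀ f m → inv f (suc m) Tᵣ.≈ Tᵣ.- ΣT.sum (suc m) (λ i → f (suc i) Tᵣ.* inv f (m ∸ i))
inv-suc f m = Tᵣ.-‿cong (ΣFinT≈sum (suc m) _ _ (λ i → InT.coefficientwise λ k →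
  ≡.trans (*T≡*ˢ (f (suc (toℕ i))) (lookup (invVec f m) i) k)
          (≡.cong (λ g → (f (suc (toℕ i)) InT.*ˢ g) k) (lookup-invVec f m i))))

inv-inverse : ∀ f → f 0 Tᵣ.≈ Tᵣ.1# → f * inv f ≈ 1#
inv-inverse f f₀≈1 = InQ.coefficientwise coefficient
  where
  open import Relation.Binary.Reasoning.Setoid Tᵣ.setoid
  coefficient : ∀ m → (f * inv f) m Tᵣ.≈ 1# m
  coefficient zero = Tᵣ.trans (Tᵣ.+-identityˡ _)
    (Tᵣ.trans (Tᵣ.*-cong f₀≈1 (InQ.≋-at 1S≈1 zero)) (Tᵣ.*-identityˡ Tᵣ.1#))
  coefficient (suc m) = begin
    (f * inv f) (suc m)                         ≈⟨ ΣT.sum-unfoldˡ (suc m) _ ⟩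
    f 0 Tᵣ.* inv f (suc m) Tᵣ.+ Σ               ≈⟨ Tᵣ.+-congʳ (Tᵣ.*-cong f₀≈1 (inv-suc f m)) ⟩
    Tᵣ.1# Tᵣ.* (Tᵣ.- Σ) Tᵣ.+ Σ                  ≈⟨ Tᵣ.+-congʳ (Tᵣ.*-identityˡ (Tᵣ.- Σ)) ⟩
    Tᵣ.- Σ Tᵣ.+ Σ                               ≈⟨ Tᵣ.-‿inverseˡ Σ ⟩
    Tᵣ.0#                                       ∎
    where
    Σ = ΣT.sum (suc m) (λ i → f (suc i) Tᵣ.* inv f (m ∸ i))

open InQ using (X^_∣_; _≈[X^_]_; X^∣-resp-≋; X^∣-weaken; X^∣-monomial; X^∣-*; X^∣-*ˡ; X^∣-*ʳ;
                ≈[X^]⇒≈; ≈⇒≈[X^]; ≋⇒≈[X^]; ≈[X^]-sym; ≈[X^]-trans; ≈[X^]-weaken; ≈[X^]-*;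
                ≈[X^]-sum; X^∣⇒+-≈[X^]; prod-1-≈[X^]-1; prod-truncate)
open import Relation.Binary.Reasoning.Setoid setoid

X^∣x^ : ∀ j → X^ (2 ℕ.* j) ∣ x^ j
X^∣x^ j = X^∣-resp-≋ (sym (x^≈monomial j)) (X^∣-monomial (2 ℕ.* j) 1ᵗ)

X^∣mono : ∀ c a b → X^ a ∣ mono c a b
X^∣mono c a b = X^∣-resp-≋ (sym (mono≈monomial c a b)) (X^∣-monomial a (InT.monomial b c))

poch-stable : ∀ c d e {K K′} → K ≤ K′ → poch c d e 2 K′ ≈[X^ d ℕ.+ 2 ℕ.* K ] poch c d e 2 K
poch-stable c d e {K} {K′} K≤K′ = ≈[X^]-trans (≋⇒≈[X^] (poch≈qPoch c d e K′))
  (≈[X^]-trans (≡.subst (λ n → qPoch M n ≈[X^ d ℕ.+ 2 ℕ.* K ] qPoch M K) (ℕ.m+[n∸m]≡n K≤K′)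
                        (prod-truncate K (K′ ∸ K) (λ j → M * x^ j) X^∣-tail))
               (≋⇒≈[X^] (sym (poch≈qPoch c d e K))))
  where
  M = mono c d e
  X^∣-tail : ∀ i → X^ d ℕ.+ 2 ℕ.* K ∣ M * x^ (K ℕ.+ i)
  X^∣-tail i = X^∣-weaken (ℕ.+-monoʳ-≤ d (ℕ.*-monoʳ-≤ 2 (ℕ.m≤m+n K i)))
    (X^∣-resp-≋ (sym (mono-shift c d e (K ℕ.+ i))) (X^∣mono c (d ℕ.+ 2 ℕ.* (K ℕ.+ i)) e))

pochInf≈[X^]poch : ∀ c d e N → pochInf c d e 2 ≈[X^ d ℕ.+ 2 ℕ.* N ] poch c d e 2 N
pochInf≈[X^]poch c d e N = ≈⇒≈[X^] coefficient
  where
  coefficient : ∀ m → m < d ℕ.+ 2 ℕ.* N → pochInf c d e 2 m Tᵣ.≈ poch c d e 2 N m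
  coefficient m m<d+2N with ℕ.≤-total (suc m) N
  ... | inj₁ m<N = Tᵣ.sym (≈[X^]⇒≈ (poch-stable c d e m<N) m
                     (ℕ.≤-trans (s≤s (ℕ.m≤m+n m _)) (ℕ.m≤n+m (2 ℕ.* suc m) d)))
  ... | inj₂ N≤m = ≈[X^]⇒≈ (poch-stable c d e N≤m) m m<d+2N

poch-constant-term : ∀ c d e K → 1 ≤ d → poch c d e 2 K 0 Tᵣ.≈ Tᵣ.1#
poch-constant-term c d e K 1≤d =
  Tᵣ.trans (≈[X^]⇒≈ (poch-stable c d e {K′ = K} z≤n) 0 (ℕ.≤-trans 1≤d (ℕ.m≤m+n d 0))) (InQ.≋-at 1S≈1 zero)

open IntegerCoefficientSolver ℤ[[t]][[q]] using (solve; _:=_; _:+_; _:*_; :-_)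
open Summation ℤ[[t]][[q]] using (sum; sum-cong′)
open Inverses ℤ[[t]][[q]] using (inverse-difference)

n≤triangular : ∀ n → n ≤ triangular n
n≤triangular zero    = z≤n
n≤triangular (suc n) = ℕ.m≤n+m (suc n) (triangular n)

n[n+1]≡2triangular : ∀ n → n ℕ.* suc n ≡ 2 ℕ.* triangular n
n[n+1]≡2triangular zero    = ≡.refl
n[n+1]≡2triangular (suc n) = ≡.trans (expand n)
  (≡.trans (≡.cong (ℕ._+ 2 ℕ.* suc n) (n[n+1]≡2triangular n)) (≡.sym (ℕ.*-distribˡ-+ 2 (triangular n) (suc n))))
  where
  expand : ∀ n → suc n ℕ.* suc (suc n) ≡ n ℕ.* suc n ℕ.+ 2 ℕ.* suc n
  expand = solve-∀

a : S
a = mono 1ℤ 1 1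

A⁻¹ Q⁻¹ : ℕ → S
A⁻¹ k = inv (poch 1ℤ 1 1 2 k)
Q⁻¹ k = inv (poch 1ℤ 2 0 2 k)

A-inverse : ∀ k → qPoch a k * A⁻¹ k ≈ 1#
A-inverse k = trans (*-congʳ {A⁻¹ k} (sym (poch≈qPoch 1ℤ 1 1 k)))
                    (inv-inverse (poch 1ℤ 1 1 2 k) (poch-constant-term 1ℤ 1 1 k (s≤s z≤n)))

Q-inverse : ∀ k → qPoch x k * Q⁻¹ k ≈ 1#
Q-inverse k = trans (*-congʳ {Q⁻¹ k} (sym (poch≈qPoch 1ℤ 2 0 k)))
                    (inv-inverse (poch 1ℤ 2 0 2 k) (poch-constant-term 1ℤ 2 0 k (s≤s z≤n)))

mono-neg : ∀ d e → mono -1ℤ d e ≈ - mono 1ℤ d e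
mono-neg d e = begin
  mono -1ℤ d e                                  ≈⟨ mono≈monomial -1ℤ d e ⟩
  InQ.monomial d (InT.monomial e (ℤ.- 1ℤ))      ≈⟨ InQ.monomial-cong d (InT.monomial-neg e 1ℤ) ⟩
  InQ.monomial d (Tᵣ.- InT.monomial e 1ℤ)       ≈⟨ InQ.monomial-neg d (InT.monomial e 1ℤ) ⟩
  - InQ.monomial d (InT.monomial e 1ℤ)          ≈⟨ -‿cong (sym (mono≈monomial 1ℤ d e)) ⟩
  - mono 1ℤ d e                                 ∎

x^triangular≈mono : ∀ n → mono 1ℤ (n ℕ.* suc n) 0 ≈ x^ triangular n
x^triangular≈mono n = trans (mono≈monomial 1ℤ _ 0)
  (trans (reflexive (≡.cong (λ i → InQ.monomial i 1ᵗ) (n[n+1]≡2triangular n))) (sym (x^≈monomial (triangular n))))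

summand≈ : ∀ n → summand n ≈ x^ triangular n * qPoch (- a) n * Q⁻¹ n * A⁻¹ (suc n)
summand≈ n = begin
  summand n                                         ≈⟨ *S≈* ((μ *S B) *S Q⁻¹ n) (A⁻¹ (suc n)) ⟩
  ((μ *S B) *S Q⁻¹ n) * A⁻¹ (suc n)                 ≈⟨ *-congʳ {A⁻¹ (suc n)} (*S≈* (μ *S B) (Q⁻¹ n)) ⟩
  (μ *S B) * Q⁻¹ n * A⁻¹ (suc n)                    ≈⟨ *-congʳ {A⁻¹ (suc n)} (*-congʳ {Q⁻¹ n} (*S≈* μ B)) ⟩
  μ * B * Q⁻¹ n * A⁻¹ (suc n)
    ≈⟨ *-congʳ {A⁻¹ (suc n)} (*-congʳ {Q⁻¹ n} (*-cong (x^triangular≈mono n) B≈)) ⟩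
  x^ triangular n * qPoch (- a) n * Q⁻¹ n * A⁻¹ (suc n) ∎
  where
  μ = mono 1ℤ (n ℕ.* suc n) 0
  B = poch -1ℤ 1 1 2 n
  B≈ : B ≈ qPoch (- a) n
  B≈ = trans (poch≈qPoch -1ℤ 1 1 n) (qPoch-cong n (mono-neg 1 1))

partialSum≈sum : ∀ K → partialSum K ≈ sum K summand
partialSum≈sum zero    = refl
partialSum≈sum (suc K) = trans (+S≈+ (partialSum K) (summand K)) (+-congʳ (partialSum≈sum K))

precision : ℕ → ℕ
precision N = 2 ℕ.+ 2 ℕ.* N

-- The truncated q-binomial coefficient differs from 1/(x;x)_n by a multiple of x^(N-n+1), and the
-- factor x^(n(n+1)/2) supplies the missing power x^n.
term≈[X^] : ∀ N n → n ≤ N →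
  x^ triangular n * qBinomial N n * qPoch (- a) n * A⁻¹ (suc n)
    ≈[X^ precision N ] x^ triangular n * qPoch (- a) n * Q⁻¹ n * A⁻¹ (suc n)
term≈[X^] N n n≤N = InQ.X^∣-difference (X^∣-resp-≋ rearrange
  (X^∣-*ʳ (qPoch (- a) n * A⁻¹ (suc n)) (X^∣-weaken precision≤ (X^∣-* (X^∣x^ (triangular n)) qBinomial-Q⁻¹))))
  where
  m = N ∸ n
  qBinomial-Q⁻¹ : X^ 2 ℕ.* suc m ∣ qBinomial N n + - Q⁻¹ n
  qBinomial-Q⁻¹ = X^∣-resp-≋ (sym (qBinomial-sub-inverse Q⁻¹ Q-inverse N n≤N))
    (X^∣-*ˡ (Q⁻¹ n) (InQ.divides-difference
      (prod-1-≈[X^]-1 n (λ i → x^ suc m * x^ i) (λ i → X^∣-*ʳ (x^ i) (X^∣x^ (suc m))))))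
  precision≤ : precision N ≤ 2 ℕ.* triangular n ℕ.+ 2 ℕ.* suc m
  precision≤ = ℕ.≤-trans (ℕ.≤-reflexive (≡.trans (≡.sym (ℕ.*-suc 2 N))
         (≡.trans (≡.cong (λ k → 2 ℕ.* suc k) (≡.sym (ℕ.m+[n∸m]≡n n≤N)))
         (≡.trans (≡.cong (2 ℕ.*_) (≡.sym (ℕ.+-suc n m))) (ℕ.*-distribˡ-+ 2 n (suc m))))))
       (ℕ.+-monoˡ-≤ (2 ℕ.* suc m) (ℕ.*-monoʳ-≤ 2 (n≤triangular n)))
  rearrange : x^ triangular n * (qBinomial N n + - Q⁻¹ n) * (qPoch (- a) n * A⁻¹ (suc n))
    ≈ x^ triangular n * qBinomial N n * qPoch (- a) n * A⁻¹ (suc n) + - (x^ triangular n * qPoch (- a) n * Q⁻¹ n * A⁻¹ (suc n))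
  rearrange = solve 5 (λ X B Q P A → X :* (B :+ :- Q) :* (P :* A) := X :* B :* P :* A :+ :- (X :* P :* Q :* A)) refl
    (x^ triangular n) (qBinomial N n) (Q⁻¹ n) (qPoch (- a) n) (A⁻¹ (suc n))

partialSum≈[X^] : ∀ N → partialSum (suc N) ≈[X^ precision N ] qPoch (- x) N * A⁻¹ (suc N)
partialSum≈[X^] N = ≈[X^]-trans (≋⇒≈[X^] (trans (partialSum≈sum (suc N)) (sum-cong′ (suc N) summand≈)))
  (≈[X^]-trans (≈[X^]-sum (suc N) (λ n n<1+N → ≈[X^]-sym (term≈[X^] N n (ℕ.≤-pred n<1+N))))
               (≋⇒≈[X^] (finite-identity-divided a A⁻¹ A-inverse N)))

rhs≈[X^] : ∀ N → rhs ≈[X^ precision N ] qPoch (- x) N * A⁻¹ (suc N)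
rhs≈[X^] N = ≈[X^]-trans (≋⇒≈[X^] (*S≈* (pochInf -1ℤ 2 0 2) (inv A∞)))
  (≈[X^]-* (≈[X^]-trans (pochInf≈[X^]poch -1ℤ 2 0 N)
                        (≋⇒≈[X^] (trans (poch≈qPoch -1ℤ 2 0 N) (qPoch-cong N (mono-neg 2 0)))))
           A∞⁻¹≈[X^])
  where
  A∞ = pochInf 1ℤ 1 1 2
  A∞-inverse : A∞ * inv A∞ ≈ 1#
  A∞-inverse = inv-inverse A∞ (poch-constant-term 1ℤ 1 1 1 (s≤s z≤n))
  A∞⁻¹≈[X^] : inv A∞ ≈[X^ precision N ] A⁻¹ (suc N)
  A∞⁻¹≈[X^] = InQ.X^∣-difference (X^∣-resp-≋
    (sym (inverse-difference {A∞} {inv A∞} {poch 1ℤ 1 1 2 (suc N)} A∞-inverse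
      (inv-inverse (poch 1ℤ 1 1 2 (suc N)) (poch-constant-term 1ℤ 1 1 (suc N) (s≤s z≤n)))))
    (X^∣-*ˡ (inv A∞ * A⁻¹ (suc N))
      (InQ.divides-difference (≈[X^]-weaken precision≤ (≈[X^]-sym (pochInf≈[X^]poch 1ℤ 1 1 (suc N)))))))
    where
    precision≤ : precision N ≤ 1 ℕ.+ 2 ℕ.* suc N
    precision≤ = ℕ.≤-trans (ℕ.m≤n+m (precision N) 1) (ℕ.≤-reflexive (≡.cong suc (≡.sym (ℕ.*-suc 2 N))))

partialSum-stable : ∀ N k → partialSum (suc N ℕ.+ k) ≈[X^ precision N ] partialSum (suc N)
partialSum-stable N zero    = ≋⇒≈[X^] (reflexive (≡.cong partialSum (ℕ.+-identityʳ (suc N))))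
partialSum-stable N (suc k) = ≈[X^]-trans
  (≡.subst (λ i → partialSum i ≈[X^ precision N ] partialSum j) (≡.sym (ℕ.+-suc (suc N) k))
    (≈[X^]-trans (≋⇒≈[X^] (+S≈+ (partialSum j) (summand j))) (X^∣⇒+-≈[X^] (partialSum j) X^∣summand)))
  (partialSum-stable N k)
  where
  j = suc N ℕ.+ k
  X^∣summand : X^ precision N ∣ summand j
  X^∣summand = X^∣-resp-≋ (sym (summand≈ j))
    (X^∣-*ʳ (A⁻¹ (suc j)) (X^∣-*ʳ (Q⁻¹ j) (X^∣-*ʳ (qPoch (- a) j) (X^∣-weaken precision≤ (X^∣x^ (triangular j))))))
    where
    precision≤ : precision N ≤ 2 ℕ.* triangular j
    precision≤ = ℕ.≤-trans (ℕ.≤-reflexive (≡.sym (ℕ.*-suc 2 N)))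
           (ℕ.*-monoʳ-≤ 2 (ℕ.≤-trans (ℕ.m≤m+n (suc N) k) (n≤triangular j)))

partialSum≈[X^]rhs : ∀ N {N′} → suc N ≤ N′ → partialSum N′ ≈[X^ precision N ] rhs
partialSum≈[X^]rhs N {N′} N<N′ = ≡.subst (λ i → partialSum i ≈[X^ precision N ] rhs) (ℕ.m+[n∸m]≡n N<N′)
  (≈[X^]-trans (partialSum-stable N (N′ ∸ suc N)) (≈[X^]-trans (partialSum≈[X^] N) (≈[X^]-sym (rhs≈[X^] N))))

theorem1p13 : (m : ℕ) → ∃ λ N → (N' : ℕ) → N ≤ N' → (k : ℕ) →
    partialSum N' m k ≡ rhs m k
theorem1p13 m = suc m , λ N′ m<N′ → InT.≋-at (≈[X^]⇒≈ (partialSum≈[X^]rhs m m<N′) m m<precision)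
  where
  m<precision : m < precision m
  m<precision = ℕ.≤-trans (ℕ.n<1+n m) (ℕ.≤-trans (ℕ.m≤n+m (suc m) 1) (ℕ.+-monoʳ-≤ 2 (ℕ.m≤n*m m 2)))
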